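{- Let $\{l_i=v_i\}_{i\in I}$ and $\{l_j=w_j\}_{j\in J}$ be two records (with $v_i,w_j$ values). If $k$ is an index with $k\in I$ and $k\notin J$, then $\{l_i=v_i\}_{i\in I}\not\equiv\{l_j=w_j\}_{j\in J}$.
   Context: Fix pairwise disjoint countably infinite sets of $\lambda$-variables ($x,y,\dots$), stack variables ($\alpha,\beta,\dots$), term variables ($a,b,\dots$), and countable sets of labels $l$ (indexed, with distinct indices denoting distinct labels) and constructors $C$. Values, terms, stacks, processes: $v,w::=x\mid\lambda x\,t\mid C[v]\mid\{l_i=v_i\}_{i\in I}$; $t,u::=a\mid v\mid t\,u\mid\mu\alpha\,t\mid p\mid v.l\mid\mathrm{case}_v[C_i[x_i]\to t_i]_{i\in I}\mid\delta_{v,w}$; $\pi::=\alpha\mid v.\pi\mid[t]\pi$; $p::=t\ast\pi$; $I$ finite; $\lambda x$, $\mu\alpha$ and the $x_i$ in case branches are binders, term variables are never bound. Substitutions map $\lambda$-variables to values, stack variables to stacks, term variables to terms (capture-avoiding). $\succ$ is the smallest relation on processes with: $t\,u\ast\pi\succ u\ast[t]\pi$; $v\ast[t]\pi\succ t\ast v.\pi$; $\lambda x\,t\ast v.\pi\succ t[x:=v]\ast\pi$; $\mu\alpha\,t\ast\pi\succ t[\alpha:=\pi]\ast\pi$; $p\ast\pi\succ p$; $\{l_i=v_i\}_{i\in I}.l_k\ast\pi\succ v_k\ast\pi$ ($k\in I$); $\mathrm{case}_{C_k[v]}[C_i[x_i]\to t_i]_{i\in I}\ast\pi\succ t_k[x_k:=v]\ast\pi$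 ($k\in I$). A process is final if it is $v\ast\alpha$ with $v$ a value and $\alpha$ a stack variable; for a relation $R$, $p\Downarrow_R$ means $p\,R^*\,q$ with $q$ final. For $i\in\mathbb N$, inductively: $\rightsquigarrow_i=\succ\cup\{(\delta_{v,w}\ast\pi,v\ast\pi)\mid\exists j<i,\ v\not\equiv_jw\}$; $t\equiv_iu$ iff for all $j\le i$, stacks $\pi$, substitutions $\sigma$: $t\sigma\ast\pi\Downarrow_{\rightsquigarrow_j}\Leftrightarrow u\sigma\ast\pi\Downarrow_{\rightsquigarrow_j}$; $\not\equiv_i$ is its negation. $\equiv=\bigcap_i\equiv_i$ and $\not\equiv$ is its negation. -}

module Defs where

open import Data.Nat using (ℕ; zero; suc)
open import Data.List using (List; []; _∷_)
open import Data.Maybe using (Maybe; just; nothing)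
open import Data.Product using (Σ; ∃; _×_; _,_)
open import Data.Sum using (_⊎_)
open import Data.Empty using (⊥)
open import Function using (id)
open import Relation.Binary.PropositionalEquality using (_≡_)
open import Function.Bundles using (_⇔_)
open import Relation.Nullary using (¬_)
open import Relation.Binary.Construct.Closure.ReflexiveTransitive using (Star)

-- Syntax (locally nameless / de Bruijn).
-- λ-variables and stack variables are de Bruijn indices (ℕ); index 0 is
-- the innermost binder (λ / case branch for λ-variables, μ for stack
-- variables); indices beyond the binders are the free variables.
-- Term variables are never bound, named by ℕ.
-- Labels l_n and constructors C_n are named by their index n : ℕ.
-- A record {l_i = v_i}_{i∈I} is a finite partial map ℕ ⇀ Val, encoded as
-- a list r : List (Maybe Val) with  I = { i | lookupM r i ≡ just _ }.
-- Likewise the branches [C_i[x_i] → t_i]_{i∈I} of a case are a finite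
-- partial map ℕ ⇀ Tm (each branch body binds the λ-variable 0).

infix 5 _∗_

mutual
  data Val : Set where
    var  : ℕ → Val
    lam  : Tm → Val
    cons : ℕ → Val → Val
    rec  : List (Maybe Val) → Val

  data Tm : Set where
    tvar  : ℕ → Tm
    val   : Val → Tm
    app   : Tm → Tm → Tm
    mu    : Tm → Tm
    proc  : Proc → Tm
    proj  : Val → ℕ → Tm
    case  : Val → List (Maybe Tm) → Tm
    delta : Val → Val → Tm

  data Stk : Set where
    svar  : ℕ → Stk
    push  : Val → Stk → Stk
    frame : Tm → Stk → Stk

  data Proc : Set where
    _∗_ : Tm → Stk → Proc

lookupM : {A : Set} → List (Maybe A) → ℕ → Maybe A
lookupM []      _       = nothing
lookupM (m ∷ _) zero    = m
lookupM (_ ∷ r) (suc n) = lookupM r n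

ext : (ℕ → ℕ) → ℕ → ℕ
ext ρ zero    = zero
ext ρ (suc n) = suc (ρ n)

mutual
  renV : (ℕ → ℕ) → (ℕ → ℕ) → Val → Val
  renV ρ κ (var x)    = var (ρ x)
  renV ρ κ (lam t)    = lam (renT (ext ρ) κ t)
  renV ρ κ (cons c v) = cons c (renV ρ κ v)
  renV ρ κ (rec r)    = rec (renR ρ κ r)

  renR : (ℕ → ℕ) → (ℕ → ℕ) → List (Maybe Val) → List (Maybe Val)
  renR ρ κ []             = []
  renR ρ κ (nothing ∷ r)  = nothing ∷ renR ρ κ r
  renR ρ κ (just v ∷ r)   = just (renV ρ κ v) ∷ renR ρ κ r

  renB : (ℕ → ℕ) → (ℕ → ℕ) → List (Maybe Tm) → List (Maybe Tm)
  renB ρ κ []             = []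
  renB ρ κ (nothing ∷ bs) = nothing ∷ renB ρ κ bs
  renB ρ κ (just t ∷ bs)  = just (renT (ext ρ) κ t) ∷ renB ρ κ bs

  renT : (ℕ → ℕ) → (ℕ → ℕ) → Tm → Tm
  renT ρ κ (tvar a)      = tvar a
  renT ρ κ (val v)       = val (renV ρ κ v)
  renT ρ κ (app t u)     = app (renT ρ κ t) (renT ρ κ u)
  renT ρ κ (mu t)        = mu (renT ρ (ext κ) t)
  renT ρ κ (proc p)      = proc (renP ρ κ p)
  renT ρ κ (proj v l)    = proj (renV ρ κ v) l
  renT ρ κ (case v bs)   = case (renV ρ κ v) (renB ρ κ bs)
  renT ρ κ (delta v w)   = delta (renV ρ κ v) (renV ρ κ w)

  renS : (ℕ → ℕ) → (ℕ → ℕ) → Stk → Stk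
  renS ρ κ (svar α)    = svar (κ α)
  renS ρ κ (push v π)  = push (renV ρ κ v) (renS ρ κ π)
  renS ρ κ (frame t π) = frame (renT ρ κ t) (renS ρ κ π)

  renP : (ℕ → ℕ) → (ℕ → ℕ) → Proc → Proc
  renP ρ κ (t ∗ π) = renT ρ κ t ∗ renS ρ κ π

record Subst : Set where
  field
    vs : ℕ → Val
    ss : ℕ → Stk
    ts : ℕ → Tm
open Subst public

liftλ : Subst → Subst
vs (liftλ σ) zero    = var zero
vs (liftλ σ) (suc n) = renV suc id (vs σ n)
ss (liftλ σ) n       = renS suc id (ss σ n)
ts (liftλ σ) a       = renT suc id (ts σ a)

liftμ : Subst → Subst
vs (liftμ σ) n       = renV id suc (vs σ n)
ss (liftμ σ) zero    = svar zero
ss (liftμ σ) (suc n) = renS id suc (ss σ n)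
ts (liftμ σ) a       = renT id suc (ts σ a)

mutual
  subV : Subst → Val → Val
  subV σ (var x)    = vs σ x
  subV σ (lam t)    = lam (subT (liftλ σ) t)
  subV σ (cons c v) = cons c (subV σ v)
  subV σ (rec r)    = rec (subR σ r)

  subR : Subst → List (Maybe Val) → List (Maybe Val)
  subR σ []            = []
  subR σ (nothing ∷ r) = nothing ∷ subR σ r
  subR σ (just v ∷ r)  = just (subV σ v) ∷ subR σ r

  subB : Subst → List (Maybe Tm) → List (Maybe Tm)
  subB σ []             = []
  subB σ (nothing ∷ bs) = nothing ∷ subB σ bs
  subB σ (just t ∷ bs)  = just (subT (liftλ σ) t) ∷ subB σ bs

  subT : Subst → Tm → Tm
  subT σ (tvar a)    = ts σ a
  subT σ (val v)     = val (subV σ v)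
  subT σ (app t u)   = app (subT σ t) (subT σ u)
  subT σ (mu t)      = mu (subT (liftμ σ) t)
  subT σ (proc p)    = proc (subP σ p)
  subT σ (proj v l)  = proj (subV σ v) l
  subT σ (case v bs) = case (subV σ v) (subB σ bs)
  subT σ (delta v w) = delta (subV σ v) (subV σ w)

  subS : Subst → Stk → Stk
  subS σ (svar α)    = ss σ α
  subS σ (push v π)  = push (subV σ v) (subS σ π)
  subS σ (frame t π) = frame (subT σ t) (subS σ π)

  subP : Subst → Proc → Proc
  subP σ (t ∗ π) = subT σ t ∗ subS σ π

_[0≔_] : Tm → Val → Tm
t [0≔ v ] = subT σ t
  where
    σ : Subst
    vs σ zero    = v
    vs σ (suc n) = var n
    ss σ n       = svar n
    ts σ a       = tvar a

_[α0≔_] : Tm → Stk → Tm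
t [α0≔ π ] = subT σ t
  where
    σ : Subst
    vs σ n       = var n
    ss σ zero    = π
    ss σ (suc n) = svar n
    ts σ a       = tvar a

infix 4 _≻_
data _≻_ : Proc → Proc → Set where
  ≻-app   : ∀ {t u π} → app t u ∗ π ≻ u ∗ frame t π
  ≻-frame : ∀ {v t π} → val v ∗ frame t π ≻ t ∗ push v π
  ≻-lam   : ∀ {t v π} → val (lam t) ∗ push v π ≻ (t [0≔ v ]) ∗ π
  ≻-mu    : ∀ {t π} → mu t ∗ π ≻ (t [α0≔ π ]) ∗ π
  ≻-proc  : ∀ {p π} → proc p ∗ π ≻ p
  ≻-proj  : ∀ {r k v π} → lookupM r k ≡ just v → proj (rec r) k ∗ π ≻ val v ∗ π
  ≻-case  : ∀ {bs k v t π} → lookupM bs k ≡ just t →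
            case (cons k v) bs ∗ π ≻ (t [0≔ v ]) ∗ π

Final : Proc → Set
Final p = ∃ λ v → ∃ λ α → p ≡ (val v ∗ svar α)

_⇓_ : Proc → (Proc → Proc → Set) → Set
p ⇓ R = ∃ λ q → Star R p q × Final q

data Red (D : Val → Val → Set) : Proc → Proc → Set where
  ↝-≻ : ∀ {p q} → p ≻ q → Red D p q
  ↝-δ : ∀ {v w π} → D v w → Red D (delta v w ∗ π) (val v ∗ π)

Agree : (Val → Val → Set) → Tm → Tm → Set
Agree D t u = ∀ (π : Stk) (σ : Subst) →
  ((subT σ t ∗ π) ⇓ (Red D)) ⇔ ((subT σ u ∗ π) ⇓ (Red D))

-- The stratified relations, by structural mutual recursion on i:
--   Dδ i v w  ≈  ∃ j < i, v ≢_j w   (unrolled as a disjunction),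
--   so that  ↝_i = ↝⟨ Dδ i ⟩ ;
--   t ≡[ i ] u  ≈  ∀ j ≤ i, Agree (Dδ j) t u   (unrolled as a conjunction).

mutual
  Dδ : ℕ → Val → Val → Set
  Dδ zero    v w = ⊥
  Dδ (suc i) v w = Dδ i v w ⊎ ¬ (val v ≡[ i ] val w)

  _≡[_]_ : Tm → ℕ → Tm → Set
  t ≡[ zero ]  u = Agree (Dδ zero) t u
  t ≡[ suc i ] u = (t ≡[ i ] u) × Agree (Dδ (suc i)) t u

_≡∞_ : Tm → Tm → Set
t ≡∞ u = ∀ i → t ≡[ i ] u

_≢∞_ : Tm → Tm → Set
t ≢∞ u = ¬ (t ≡∞ u)

_∈dom_ : ℕ → List (Maybe Val) → Set
k ∈dom r = ∃ λ v → lookupM r k ≡ just v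

-- The stack [λx. x.l_k]α, which contains no δ, separates the two records
-- already at level 0: against it {l_i = v_i} runs to v_k, while the other
-- record gets stuck projecting a missing label. Substitutions leave record domains
-- unchanged, so the separation survives the quantification over σ.
module Submission where

open import Defs
open import Data.Nat using (ℕ; zero; suc)
open import Data.List using (List; []; _∷_)
open import Data.Maybe using (Maybe; just; nothing; map)
open import Data.Maybe.Properties using (map-just)
open import Data.Product using (_,_)
open import Function.Bundles using (Equivalence)
open import Relation.Binary.PropositionalEquality using (_≡_; refl; sym; trans)
open import Relation.Binary.Construct.Closure.ReflexiveTransitive using (ε; _◅_)
open import Relation.Nullary using (¬_)

lookupM-subR : ∀ σ r k → lookupM (subR σ r) k ≡ map (subV σ) (lookupM r k)
lookupM-subR σ []            k       = refl
lookupM-subR σ (nothing ∷ r) zero    = refl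
lookupM-subR σ (just v ∷ r)  zero    = refl
lookupM-subR σ (nothing ∷ r) (suc k) = lookupM-subR σ r k
lookupM-subR σ (just v ∷ r)  (suc k) = lookupM-subR σ r k

∈dom-subR⁺ : ∀ σ r {k} → k ∈dom r → k ∈dom subR σ r
∈dom-subR⁺ σ r {k} (v , r[k]≡v) = subV σ v , trans (lookupM-subR σ r k) (map-just r[k]≡v)

∈dom-subR⁻ : ∀ σ r {k} → k ∈dom subR σ r → k ∈dom r
∈dom-subR⁻ σ r {k} (w , eq) with lookupM r k | trans (sym (lookupM-subR σ r k)) eq
... | just v  | _  = v , refl
... | nothing | ()

projection-context : ℕ → Stk
projection-context k = frame (val (lam (proj (var zero) k))) (svar zero)

proj-rec-stuck : ∀ {D s k π} → ¬ k ∈dom s → ¬ ((proj (rec s) k ∗ π) ⇓ Red D)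
proj-rec-stuck k∉s (_ , ε , _ , _ , ())
proj-rec-stuck k∉s (_ , ↝-≻ (≻-proj s[k]≡v) ◅ _ , _) = k∉s (_ , s[k]≡v)

projection-context-⇓ : ∀ {D s k} → k ∈dom s → (val (rec s) ∗ projection-context k) ⇓ Red D
projection-context-⇓ (v , s[k]≡v) =
  val v ∗ svar zero , ↝-≻ ≻-frame ◅ ↝-≻ ≻-lam ◅ ↝-≻ (≻-proj s[k]≡v) ◅ ε , v , zero , refl

projection-context-stuck : ∀ {D s k} → ¬ k ∈dom s → ¬ ((val (rec s) ∗ projection-context k) ⇓ Red D)
projection-context-stuck k∉s (_ , ε , _ , _ , ())
projection-context-stuck k∉s (_ , ↝-≻ ≻-frame ◅ ε , _ , _ , ())
projection-context-stuck k∉s (_ , ↝-≻ ≻-frame ◅ ↝-≻ ≻-lam ◅ steps , final) =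
  proj-rec-stuck k∉s (_ , steps , final)

idSubst : Subst
vs idSubst = var
ss idSubst = svar
ts idSubst = tvar

theorem12 : (r₁ r₂ : List (Maybe Val)) (k : ℕ) →
    k ∈dom r₁ → ¬ (k ∈dom r₂) →
    val (rec r₁) ≢∞ val (rec r₂)
theorem12 r₁ r₂ k k∈r₁ k∉r₂ r₁≡r₂ =
  projection-context-stuck (λ k∈r₂ → k∉r₂ (∈dom-subR⁻ idSubst r₂ k∈r₂))
    (Equivalence.to (r₁≡r₂ zero (projection-context k) idSubst)
      (projection-context-⇓ (∈dom-subR⁺ idSubst r₁ k∈r₁)))
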